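{- Let $m,n\ge 5$ be integers. Then the disjunctive domination number of the torus grid graph $C_m\Box C_n$ satisfies $$\frac{mn}{9}\le \gamma_2^d(C_m\Box C_n)\le 2\left\lceil \frac{m}{4}\right\rceil\cdot\left\lceil\frac{n}{4}\right\rceil.$$
   Context: $C_k$ denotes the cycle on $k$ vertices. For graphs $G,H$, the Cartesian product $G\Box H$ has vertex set $V(G)\times V(H)$, with $(g,h)$ adjacent to $(g',h')$ iff either $g=g'$ and $hh'\in E(H)$, or $h=h'$ and $gg'\in E(G)$. For a graph $\Gamma$ and a vertex $v$, let $\Gamma(v)$ be the set of vertices at distance exactly $1$ from $v$ and $\Gamma_2(v)$ the set of vertices at distance exactly $2$ from $v$. A set $S\subseteq V(\Gamma)$ is a disjunctive dominating set if every vertex $v\notin S$ satisfies $|\Gamma(v)\cap S|\ge 1$ or $|\Gamma_2(v)\cap S|\ge 2$. The disjunctive domination number $\gamma_2^d(\Gamma)$ is the minimum cardinality of a disjunctive dominating set of $\Gamma$. -}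

module Defs where

open import Level using (0ℓ)
open import Data.Nat using (ℕ; zero; suc; _+_; _*_; _≤_)
open import Data.Fin using (Fin; toℕ)
open import Data.Product using (_×_; Σ; ∃; ∃-syntax; _,_)
open import Data.Sum using (_⊎_)
open import Data.List using (List; length)
open import Data.List.Membership.Propositional using (_∈_)
open import Data.List.Relation.Unary.Unique.Propositional using (Unique)
open import Relation.Binary.PropositionalEquality using (_≡_; _≢_)
open import Relation.Nullary using (¬_)

record Graph : Set₁ where
  field
    V   : Set
    Adj : V → V → Set
open Graph public

CycleAdj : (k : ℕ) → Fin k → Fin k → Set
CycleAdj k i j =
  (suc (toℕ i) ≡ toℕ j) ⊎ (suc (toℕ j) ≡ toℕ i)
  ⊎ ((toℕ i ≡ 0) × (suc (toℕ j) ≡ k)) ⊎ ((toℕ j ≡ 0) × (suc (toℕ i) ≡ k))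

Cycle : ℕ → Graph
Cycle k = record { V = Fin k ; Adj = CycleAdj k }

_□_ : Graph → Graph → Graph
G □ H = record
  { V   = V G × V H
  ; Adj = λ { (g , h) (g' , h') →
              ((g ≡ g') × Adj H h h') ⊎ ((h ≡ h') × Adj G g g') } }

Dist1 : (Γ : Graph) → V Γ → V Γ → Set
Dist1 Γ v u = (u ≢ v) × Adj Γ v u

Dist2 : (Γ : Graph) → V Γ → V Γ → Set
Dist2 Γ v u = (u ≢ v) × ¬ Adj Γ v u × (∃[ w ] (Adj Γ v w × Adj Γ w u))

IsDisjDomSet : (Γ : Graph) → List (V Γ) → Set
IsDisjDomSet Γ S =
  Unique S ×
  (∀ v → ¬ (v ∈ S) →
     (∃[ s ] (s ∈ S × Dist1 Γ v s))
     ⊎ (∃[ s ] ∃[ t ] (s ≢ t × s ∈ S × t ∈ S × Dist2 Γ v s × Dist2 Γ v t)))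

IsDisjDomNumber : (Γ : Graph) → ℕ → Set
IsDisjDomNumber Γ γ =
  (∃[ S ] (IsDisjDomSet Γ S × length S ≡ γ)) ×
  (∀ S → IsDisjDomSet Γ S → γ ≤ length S)

Torus : ℕ → ℕ → Graph
Torus m n = Cycle m □ Cycle n

{-# OPTIONS --safe #-}
module Submission where

-- Lower bound: let every vertex s hand out weight 2 to each vertex of its closed
-- neighbourhood and weight 1 to each of the eight vertices at distance two, 18 in
-- all.  A disjunctive dominating set S gives every vertex total weight at least 2,
-- so 2mn ≤ 18|S|.
--
-- Upper bound: label position x of C_k by Z if x ≡ 0 and by T if x ≡ 2 (mod 4),
-- and by O otherwise, except that a last position k − 1 ≡ 1 (mod 4) is labelled T.
-- Then every O has a Z- and a T-neighbour, every Z has a T two steps away and every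
-- T has a Z one or two steps away, so the vertices of C_m □ C_n whose coordinates
-- are both Z or both T form a disjunctive dominating set; each label Z, T occurs at
-- most ⌈k/4⌉ times.  A minimum dominating set exists because it can be searched
-- for among the sublists of the vertex list.

open import Defs
open import Algebra.Properties.CommutativeSemigroup using (interchange)
open import Data.Bool using (Bool; true; false; if_then_else_)
open import Data.Empty using (⊥-elim)
open import Data.Fin as Fin using (Fin; zero; suc; toℕ; fromℕ; fromℕ<; inject₁; lower₁)
open import Data.Fin.Properties
  using ( toℕ-injective; toℕ<n; toℕ-fromℕ; toℕ-fromℕ<; toℕ-inject₁; toℕ-lower₁
        ; inject₁-lower₁; lower₁-inject₁′)
open import Data.List using (List; []; _∷_; _++_; [_]; map; filter; length; allFin; tabulate; cartesianProduct)
open import Data.List.Extrema.Nat using (argmin; argmin-all; f[argmin]≤f[xs])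
open import Data.List.Membership.Propositional using (_∈_; lose)
open import Data.List.Membership.Propositional.Properties
  using ( ∈-++⁺ˡ; ∈-++⁺ʳ; ∈-++⁻; ∈-map⁺; ∈-∃++; ∈-filter⁺; ∈-filter⁻; ∈-allFin
        ; ∈-cartesianProduct⁺; ∈-cartesianProduct⁻)
import Data.List.Membership.DecPropositional as DecMembership
open import Data.List.Properties using (length-++; length-map; length-tabulate; map-++; map-tabulate)
open import Data.List.Relation.Binary.Subset.Propositional using (_⊆_)
open import Data.List.Relation.Unary.All as All using (All; []; _∷_)
open import Data.List.Relation.Unary.All.Properties using (all-filter)
open import Data.List.Relation.Unary.AllPairs using ([]; _∷_)
open import Data.List.Relation.Unary.Any as Any using (here; there)
open import Data.List.Relation.Unary.Unique.Propositional using (Unique)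
import Data.List.Relation.Unary.Unique.Propositional.Properties as Unique
import Data.List.Relation.Unary.Unique.DecPropositional as DecUnique
open import Data.Nat as ℕ using (ℕ; zero; suc; _+_; _*_; _≤_; _<_; _/_; z≤n; s≤s)
open import Data.Nat.DivMod using (m/n≡1+[m∸n]/n)
open import Data.Nat.ListAction using (sum)
open import Data.Nat.ListAction.Properties using (sum-++)
open import Data.Nat.Properties hiding (_≟_)
open import Data.Product using (_×_; _,_; proj₁; proj₂; ∃-syntax)
open import Data.Product.Properties using (≡-dec)
open import Data.Sum using (_⊎_; inj₁; inj₂)
open import Function using (_∘_; id)
open import Relation.Binary.Definitions using (Symmetric; Decidable; DecidableEquality)
open import Relation.Binary.PropositionalEquality
  using (_≡_; _≢_; refl; sym; trans; cong; cong₂; subst; module ≡-Reasoning)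
open import Relation.Nullary using (¬_; Dec; yes; no; does; ¬?)
open import Relation.Nullary.Decidable using (map′; _×-dec_; _⊎-dec_; _→-dec_)

private
  variable
    A B : Set

-- Disjunctive domination in general graphs

Dominated : (Γ : Graph) → List (V Γ) → V Γ → Set
Dominated Γ S v = (∃[ s ] (s ∈ S × Dist1 Γ v s))
                ⊎ (∃[ s ] ∃[ t ] (s ≢ t × s ∈ S × t ∈ S × Dist2 Γ v s × Dist2 Γ v t))

IsDisjDomSet-resp : ∀ {Γ : Graph} {S T} → S ⊆ T → T ⊆ S → Unique T →
                    IsDisjDomSet Γ S → IsDisjDomSet Γ T
IsDisjDomSet-resp {Γ} {S} {T} S⊆T T⊆S T! (_ , dominated) = T! , λ v v∉T → dominatedᵀ v (v∉T ∘ S⊆T)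
  where
  dominatedᵀ : ∀ v → ¬ (v ∈ S) → Dominated Γ T v
  dominatedᵀ v v∉S with dominated v v∉S
  ... | inj₁ (s , s∈S , d₁)                  = inj₁ (s , S⊆T s∈S , d₁)
  ... | inj₂ (s , t , s≢t , s∈S , t∈S , d₂) = inj₂ (s , t , s≢t , S⊆T s∈S , S⊆T t∈S , d₂)

Dist2-sym : ∀ {Γ : Graph} → Symmetric (Adj Γ) → ∀ {u v} → Dist2 Γ u v → Dist2 Γ v u
Dist2-sym adj-sym (v≢u , ¬uv , w , uw , wv) =
  (λ u≡v → v≢u (sym u≡v)) , (¬uv ∘ adj-sym) , w , adj-sym wv , adj-sym uw

module CartesianProduct (G H : Graph) where

  □-Adj? : DecidableEquality (V G) → DecidableEquality (V H) → Decidable (Adj G) → Decidable (Adj H) →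
           Decidable (Adj (G □ H))
  □-Adj? _≟G_ _≟H_ G? H? (g , h) (g′ , h′) =
    ((g ≟G g′) ×-dec H? h h′) ⊎-dec ((h ≟H h′) ×-dec G? g g′)

  □-Dist1ˡ : ∀ {g g′ h} → Dist1 G g g′ → Dist1 (G □ H) (g , h) (g′ , h)
  □-Dist1ˡ (g′≢g , gg′) = (g′≢g ∘ cong proj₁) , inj₂ (refl , gg′)

  □-Dist1ʳ : ∀ {g h h′} → Dist1 H h h′ → Dist1 (G □ H) (g , h) (g , h′)
  □-Dist1ʳ (h′≢h , hh′) = (h′≢h ∘ cong proj₂) , inj₁ (refl , hh′)

  □-Dist2-diagonal : ∀ {g g′ h h′} → Dist1 G g g′ → Dist1 H h h′ →
                     Dist2 (G □ H) (g , h) (g′ , h′)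
  □-Dist2-diagonal {g} {g′} {h} {h′} (g′≢g , gg′) (h′≢h , hh′) =
    (g′≢g ∘ cong proj₁) , not-adjacent , (g′ , h) , inj₂ (refl , gg′) , inj₁ (refl , hh′)
    where
    not-adjacent : ¬ Adj (G □ H) (g , h) (g′ , h′)
    not-adjacent (inj₁ (g≡g′ , _)) = g′≢g (sym g≡g′)
    not-adjacent (inj₂ (h≡h′ , _)) = h′≢h (sym h≡h′)

  □-Dist2ˡ : ∀ {g g′ h} → Dist2 G g g′ → Dist2 (G □ H) (g , h) (g′ , h)
  □-Dist2ˡ {g} {g′} {h} (g′≢g , ¬gg′ , w , gw , wg′) =
    (g′≢g ∘ cong proj₁) , not-adjacent , (w , h) , inj₂ (refl , gw) , inj₂ (refl , wg′)
    where
    not-adjacent : ¬ Adj (G □ H) (g , h) (g′ , h)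
    not-adjacent (inj₁ (g≡g′ , _)) = g′≢g (sym g≡g′)
    not-adjacent (inj₂ (_ , gg′))  = ¬gg′ gg′

  □-Dist2ʳ : ∀ {g h h′} → Dist2 H h h′ → Dist2 (G □ H) (g , h) (g , h′)
  □-Dist2ʳ {g} {h} {h′} (h′≢h , ¬hh′ , w , hw , wh′) =
    (h′≢h ∘ cong proj₂) , not-adjacent , (g , w) , inj₁ (refl , hw) , inj₁ (refl , wh′)
    where
    not-adjacent : ¬ Adj (G □ H) (g , h) (g , h′)
    not-adjacent (inj₁ (_ , hh′))  = ¬hh′ hh′
    not-adjacent (inj₂ (h≡h′ , _)) = h′≢h (sym h≡h′)

sum-map-const : ∀ c (xs : List A) → sum (map (λ _ → c) xs) ≡ length xs * c
sum-map-const c []       = refl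
sum-map-const c (x ∷ xs) = cong (c +_) (sum-map-const c xs)

sum-map-mono : ∀ {f g : A → ℕ} xs → (∀ x → f x ≤ g x) → sum (map f xs) ≤ sum (map g xs)
sum-map-mono []       _   = z≤n
sum-map-mono (x ∷ xs) f≤g = +-mono-≤ (f≤g x) (sum-map-mono xs f≤g)

sum-map-+ : ∀ (f g : A → ℕ) xs → sum (map (λ x → f x + g x) xs) ≡ sum (map f xs) + sum (map g xs)
sum-map-+ f g []       = refl
sum-map-+ f g (x ∷ xs) =
  trans (cong (f x + g x +_) (sum-map-+ f g xs)) (interchange +-commutativeSemigroup (f x) (g x) _ _)

sum-map-swap : ∀ (f : A → B → ℕ) xs ys →
               sum (map (λ x → sum (map (f x) ys)) xs) ≡ sum (map (λ y → sum (map (λ x → f x y) xs)) ys)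
sum-map-swap f []       ys = trans (sym (*-zeroʳ (length ys))) (sym (sum-map-const 0 ys))
sum-map-swap f (x ∷ xs) ys =
  trans (cong (sum (map (f x) ys) +_) (sum-map-swap f xs ys))
        (sym (sum-map-+ (f x) (λ y → sum (map (λ x′ → f x′ y) xs)) ys))

∈⇒≤sum-map : ∀ (f : A → ℕ) {x xs} → x ∈ xs → f x ≤ sum (map f xs)
∈⇒≤sum-map f (here refl)                = m≤m+n _ _
∈⇒≤sum-map f {xs = y ∷ _} (there x∈xs) = ≤-trans (∈⇒≤sum-map f x∈xs) (m≤n+m _ (f y))

distinct-∈⇒+≤sum-map : ∀ (f : A → ℕ) {x y xs} → x ∈ xs → y ∈ xs → x ≢ y →
                       f x + f y ≤ sum (map f xs)
distinct-∈⇒+≤sum-map f (here refl) (here refl)  x≢y = ⊥-elim (x≢y refl)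
distinct-∈⇒+≤sum-map f (here refl) (there y∈xs) _   = +-monoʳ-≤ _ (∈⇒≤sum-map f y∈xs)
distinct-∈⇒+≤sum-map f {x} {y} {_ ∷ zs} (there x∈zs) (here refl) _ =
  subst (_≤ f y + sum (map f zs)) (+-comm (f y) (f x)) (+-monoʳ-≤ (f y) (∈⇒≤sum-map f x∈zs))
distinct-∈⇒+≤sum-map f {xs = z ∷ _} (there x∈xs) (there y∈xs) x≢y =
  ≤-trans (distinct-∈⇒+≤sum-map f x∈xs y∈xs x≢y) (m≤n+m _ (f z))

length-cartesianProduct : ∀ (xs : List A) (ys : List B) →
                          length (cartesianProduct xs ys) ≡ length xs * length ys
length-cartesianProduct []       ys = refl
length-cartesianProduct (x ∷ xs) ys = begin
  length (map (x ,_) ys ++ cartesianProduct xs ys)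
    ≡⟨ length-++ (map (x ,_) ys) ⟩
  length (map (x ,_) ys) + length (cartesianProduct xs ys)
    ≡⟨ cong₂ _+_ (length-map (x ,_) ys) (length-cartesianProduct xs ys) ⟩
  length ys + length xs * length ys ∎
  where open ≡-Reasoning

length-filter-∷ : ∀ {P : A → Set} (P? : ∀ x → Dec (P x)) x xs →
                  length (filter P? (x ∷ xs)) ≡
                  (if does (P? x) then suc (length (filter P? xs)) else length (filter P? xs))
length-filter-∷ P? x xs with does (P? x)
... | true  = refl
... | false = refl

length-filter-map : ∀ {P : B → Set} (P? : ∀ x → Dec (P x)) (f : A → B) xs →
                    length (filter P? (map f xs)) ≡ length (filter (P? ∘ f) xs)
length-filter-map P? f []       = refl
length-filter-map P? f (x ∷ xs) with does (P? (f x))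
... | true  = cong suc (length-filter-map P? f xs)
... | false = length-filter-map P? f xs

unique-⊆⇒length≤ : ∀ {xs ys : List A} → Unique xs → xs ⊆ ys → length xs ≤ length ys
unique-⊆⇒length≤ {xs = []}     _             _     = z≤n
unique-⊆⇒length≤ {xs = x ∷ xs} (x∉xs ∷ xs!) xs⊆ys with ∈-∃++ (xs⊆ys (here refl))
... | ys₁ , ys₂ , refl = begin
  suc (length xs)               ≤⟨ s≤s (unique-⊆⇒length≤ xs! xs⊆ys₁++ys₂) ⟩
  suc (length (ys₁ ++ ys₂))     ≡⟨ cong suc (length-++ ys₁) ⟩
  suc (length ys₁ + length ys₂) ≡⟨ sym (+-suc (length ys₁) _) ⟩
  length ys₁ + suc (length ys₂) ≡⟨ sym (length-++ ys₁) ⟩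
  length (ys₁ ++ x ∷ ys₂)       ∎
  where
  open ≤-Reasoning
  xs⊆ys₁++ys₂ : xs ⊆ ys₁ ++ ys₂
  xs⊆ys₁++ys₂ {y} y∈xs with ∈-++⁻ ys₁ (xs⊆ys (there y∈xs))
  ... | inj₁ y∈ys₁         = ∈-++⁺ˡ y∈ys₁
  ... | inj₂ (here y≡x)    = ⊥-elim (All.lookup x∉xs y∈xs (sym y≡x))
  ... | inj₂ (there y∈ys₂) = ∈-++⁺ʳ ys₁ y∈ys₂

sublists : List A → List (List A)
sublists []       = [ [] ]
sublists (x ∷ xs) = map (x ∷_) (sublists xs) ++ sublists xs

filter∈sublists : ∀ {P : A → Set} (P? : ∀ x → Dec (P x)) xs → filter P? xs ∈ sublists xs
filter∈sublists P? []       = here refl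
filter∈sublists P? (x ∷ xs) with does (P? x)
... | true  = ∈-++⁺ˡ (∈-map⁺ (x ∷_) (filter∈sublists P? xs))
... | false = ∈-++⁺ʳ (map (x ∷_) (sublists xs)) (filter∈sublists P? xs)

module FiniteType {A : Set} (_≟_ : DecidableEquality A) (elements : List A)
                  (elements! : Unique elements) (∈-elements : ∀ x → x ∈ elements) where

  open DecMembership _≟_ public using (_∈?_)

  ∃? : ∀ {P : A → Set} → (∀ x → Dec (P x)) → Dec (∃[ x ] P x)
  ∃? P? = map′ Any.satisfied (λ (x , px) → lose (∈-elements x) px) (Any.any? P? elements)

  ∀? : ∀ {P : A → Set} → (∀ x → Dec (P x)) → Dec (∀ x → P x)
  ∀? P? = map′ (λ all x → All.lookup all (∈-elements x)) (λ p → All.tabulate (λ {x} _ → p x))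
               (All.all? P? elements)

  canonical : List A → List A
  canonical S = filter (_∈? S) elements

  canonical-unique : ∀ S → Unique (canonical S)
  canonical-unique S = Unique.filter⁺ (_∈? S) elements!

  canonical⊆ : ∀ S → canonical S ⊆ S
  canonical⊆ S = proj₂ ∘ ∈-filter⁻ (_∈? S) {xs = elements}

  ⊆canonical : ∀ S → S ⊆ canonical S
  ⊆canonical S {x} = ∈-filter⁺ (_∈? S) (∈-elements x)

  length-canonical : ∀ S → length (canonical S) ≤ length S
  length-canonical S = unique-⊆⇒length≤ (canonical-unique S) (canonical⊆ S)

  shortest : ∀ {P : List A → Set} → (∀ S → Dec (P S)) → (∀ {S} → P S → P (canonical S)) →
             ∀ {S} → P S → ∃[ S* ] (P S* × ∀ T → P T → length S* ≤ length T)
  shortest {P} P? P-canonical {S} pS =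
    S* , argmin-all length (P-canonical pS) (all-filter P? (sublists elements)) , minimal
    where
    candidates = filter P? (sublists elements)
    S* = argmin length (canonical S) candidates
    minimal : ∀ T → P T → length S* ≤ length T
    minimal T pT = ≤-trans
      (All.lookup (f[argmin]≤f[xs] {f = length} (canonical S) candidates)
                  (∈-filter⁺ P? (filter∈sublists (_∈? T) elements) (P-canonical pT)))
      (length-canonical T)

  δ : A → A → ℕ
  δ x y = if does (x ≟ y) then 1 else 0

  multiplicity : A → List A → ℕ
  multiplicity x ys = sum (map (δ x) ys)

  multiplicity-++ : ∀ x ys zs → multiplicity x (ys ++ zs) ≡ multiplicity x ys + multiplicity x zs
  multiplicity-++ x ys zs = trans (cong sum (map-++ (δ x) ys zs)) (sum-++ (map (δ x) ys) _)

  ∈⇒1≤multiplicity : ∀ {x ys} → x ∈ ys → 1 ≤ multiplicity x ys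
  ∈⇒1≤multiplicity {x} {ys} x∈ys = subst (_≤ multiplicity x ys) δ-refl (∈⇒≤sum-map (δ x) x∈ys)
    where
    δ-refl : δ x x ≡ 1
    δ-refl with x ≟ x
    ... | yes _  = refl
    ... | no x≢x = ⊥-elim (x≢x refl)

  Σδ≤1 : ∀ {us} y → Unique us → sum (map (λ u → δ u y) us) ≤ 1
  Σδ≤1 {[]}     y _            = z≤n
  Σδ≤1 {u ∷ us} y (u∉us ∷ us!) with u ≟ y
  ... | yes refl = s≤s (≤-reflexive (Σδ≡0 u∉us))
    where
    Σδ≡0 : ∀ {ws} → All (u ≢_) ws → sum (map (λ w → δ w u) ws) ≡ 0
    Σδ≡0 []                = refl
    Σδ≡0 {w ∷ _} (u≢w ∷ p) with w ≟ u
    ... | yes w≡u = ⊥-elim (u≢w (sym w≡u))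
    ... | no _    = Σδ≡0 p
  ... | no _     = Σδ≤1 y us!

  Σmultiplicity≤length : ∀ ys → sum (map (λ x → multiplicity x ys) elements) ≤ length ys
  Σmultiplicity≤length []       = ≤-reflexive (trans (sum-map-const 0 elements) (*-zeroʳ (length elements)))
  Σmultiplicity≤length (y ∷ ys) = begin
    sum (map (λ x → δ x y + multiplicity x ys) elements)
      ≡⟨ sum-map-+ (λ x → δ x y) (λ x → multiplicity x ys) elements ⟩
    sum (map (λ x → δ x y) elements) + sum (map (λ x → multiplicity x ys) elements)
      ≤⟨ +-mono-≤ (Σδ≤1 y elements!) (Σmultiplicity≤length ys) ⟩
    suc (length ys) ∎
    where open ≤-Reasoning

module FiniteGraph (Γ : Graph) (_≟_ : DecidableEquality (V Γ)) (adj? : Decidable (Adj Γ))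
                   (vertices : List (V Γ)) (vertices! : Unique vertices)
                   (∈-vertices : ∀ v → v ∈ vertices) where

  open FiniteType _≟_ vertices vertices! ∈-vertices public

  Dist1? : ∀ v u → Dec (Dist1 Γ v u)
  Dist1? v u = ¬? (u ≟ v) ×-dec adj? v u

  Dist2? : ∀ v u → Dec (Dist2 Γ v u)
  Dist2? v u = ¬? (u ≟ v) ×-dec ¬? (adj? v u) ×-dec ∃? (λ w → adj? v w ×-dec adj? w u)

  IsDisjDomSet? : ∀ S → Dec (IsDisjDomSet Γ S)
  IsDisjDomSet? S = DecUnique.unique? _≟_ S ×-dec ∀? (λ v → ¬? (v ∈? S) →-dec
    (∃? (λ s → (s ∈? S) ×-dec Dist1? v s) ⊎-dec
     ∃? (λ s → ∃? (λ t → ¬? (s ≟ t) ×-dec (s ∈? S) ×-dec (t ∈? S)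
                           ×-dec Dist2? v s ×-dec Dist2? v t))))

  IsDisjDomSet-canonical : ∀ {S} → IsDisjDomSet Γ S → IsDisjDomSet Γ (canonical S)
  IsDisjDomSet-canonical {S} = IsDisjDomSet-resp (⊆canonical S) (canonical⊆ S) (canonical-unique S)

  disjDomNumber : ∀ {S} → IsDisjDomSet Γ S → ∃[ γ ] IsDisjDomNumber Γ γ
  disjDomNumber dS with shortest IsDisjDomSet? IsDisjDomSet-canonical dS
  ... | S* , dS* , minimal = length S* , (S* , dS* , refl) , minimal

  -- stamp s lists the vertices receiving weight from s, each as often as its weight.
  module Weighting (stamp : V Γ → List (V Γ)) (c : ℕ) (length-stamp : ∀ s → length (stamp s) ≡ c)
                   (stamp-self : ∀ s → 2 ≤ multiplicity s (stamp s))
                   (stamp-adj : ∀ {v s} → Adj Γ v s → 2 ≤ multiplicity v (stamp s))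
                   (stamp-walk : ∀ {v w s} → Adj Γ v w → Adj Γ w s → v ∈ stamp s) where

    weight : V Γ → List (V Γ) → ℕ
    weight v S = sum (map (λ s → multiplicity v (stamp s)) S)

    2≤weight : ∀ {S} → IsDisjDomSet Γ S → ∀ v → 2 ≤ weight v S
    2≤weight {S} (_ , dominated) v with v ∈? S
    ... | yes v∈S = ≤-trans (stamp-self v) (∈⇒≤sum-map _ v∈S)
    ... | no v∉S with dominated v v∉S
    ...   | inj₁ (s , s∈S , _ , vs) = ≤-trans (stamp-adj vs) (∈⇒≤sum-map _ s∈S)
    ...   | inj₂ (s , t , s≢t , s∈S , t∈S , (_ , _ , w , vw , ws) , (_ , _ , w′ , vw′ , w′t)) =
      ≤-trans (+-mono-≤ (∈⇒1≤multiplicity (stamp-walk vw ws))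
                        (∈⇒1≤multiplicity (stamp-walk vw′ w′t)))
              (distinct-∈⇒+≤sum-map _ s∈S t∈S s≢t)

    disjDom-lower-bound : ∀ {S} → IsDisjDomSet Γ S → 2 * length vertices ≤ c * length S
    disjDom-lower-bound {S} dS = begin
      2 * length vertices
        ≡⟨ trans (*-comm 2 (length vertices)) (sym (sum-map-const 2 vertices)) ⟩
      sum (map (λ _ → 2) vertices)
        ≤⟨ sum-map-mono vertices (2≤weight dS) ⟩
      sum (map (λ v → weight v S) vertices)
        ≡⟨ sum-map-swap (λ v s → multiplicity v (stamp s)) vertices S ⟩
      sum (map (λ s → sum (map (λ v → multiplicity v (stamp s)) vertices)) S)
        ≤⟨ sum-map-mono S (λ s → ≤-trans (Σmultiplicity≤length (stamp s))
                                         (≤-reflexive (length-stamp s))) ⟩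
      sum (map (λ _ → c) S)
        ≡⟨ trans (sum-map-const c S) (*-comm (length S) c) ⟩
      c * length S ∎
      where open ≤-Reasoning

-- Cycles

CycleAdj-sym : ∀ {k} → Symmetric (CycleAdj k)
CycleAdj-sym (inj₁ e)               = inj₂ (inj₁ e)
CycleAdj-sym (inj₂ (inj₁ e))        = inj₁ e
CycleAdj-sym (inj₂ (inj₂ (inj₁ e))) = inj₂ (inj₂ (inj₂ e))
CycleAdj-sym (inj₂ (inj₂ (inj₂ e))) = inj₂ (inj₂ (inj₁ e))

CycleAdj? : ∀ k → Decidable (CycleAdj k)
CycleAdj? k a b = (suc (toℕ a) ℕ.≟ toℕ b)
            ⊎-dec (suc (toℕ b) ℕ.≟ toℕ a)
            ⊎-dec ((toℕ a ℕ.≟ 0) ×-dec (suc (toℕ b) ℕ.≟ k))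
            ⊎-dec ((toℕ b ℕ.≟ 0) ×-dec (suc (toℕ a) ℕ.≟ k))

next prev : ∀ {k} → Fin k → Fin k
next {suc n} i with n ℕ.≟ toℕ i
... | yes _  = zero
... | no n≢i = suc (lower₁ i n≢i)
prev {suc n} zero    = fromℕ n
prev {suc n} (suc i) = inject₁ i

prev-next : ∀ {k} (a : Fin k) → prev (next a) ≡ a
prev-next {suc n} a with n ℕ.≟ toℕ a
... | yes n≡a = toℕ-injective (trans (toℕ-fromℕ n) n≡a)
... | no n≢a  = inject₁-lower₁ a n≢a

next-prev : ∀ {k} (a : Fin k) → next (prev a) ≡ a
next-prev {suc n} zero with n ℕ.≟ toℕ (fromℕ n)
... | yes _  = refl
... | no n≢n = ⊥-elim (n≢n (sym (toℕ-fromℕ n)))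
next-prev {suc n} (suc i) with n ℕ.≟ toℕ (inject₁ i)
... | yes n≡i = ⊥-elim (<⇒≢ (toℕ<n i) (sym (trans n≡i (toℕ-inject₁ i))))
... | no n≢i  = cong suc (lower₁-inject₁′ i n≢i)

next-unique : ∀ {k} {a b : Fin k} →
              suc (toℕ a) ≡ toℕ b ⊎ (toℕ b ≡ 0 × suc (toℕ a) ≡ k) → b ≡ next a
next-unique {suc n} {a} {b} step with n ℕ.≟ toℕ a | step
... | yes n≡a | inj₁ a+1≡b       = ⊥-elim (<⇒≢ (toℕ<n b) (trans (sym a+1≡b) (cong suc (sym n≡a))))
... | no n≢a  | inj₁ a+1≡b       =
  toℕ-injective (trans (sym a+1≡b) (cong suc (sym (toℕ-lower₁ a n≢a))))
... | yes _   | inj₂ (b≡0 , _)   = toℕ-injective b≡0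
... | no n≢a  | inj₂ (_ , a+1≡k) = ⊥-elim (n≢a (sym (suc-injective a+1≡k)))

next⇒prev : ∀ {k} {a b : Fin k} → a ≡ next b → b ≡ prev a
next⇒prev {b = b} refl = sym (prev-next b)

adjacent⇒next⊎prev : ∀ {k} {a b : Fin k} → CycleAdj k a b → b ≡ next a ⊎ b ≡ prev a
adjacent⇒next⊎prev (inj₁ e)               = inj₁ (next-unique (inj₁ e))
adjacent⇒next⊎prev (inj₂ (inj₁ e))        = inj₂ (next⇒prev (next-unique (inj₁ e)))
adjacent⇒next⊎prev (inj₂ (inj₂ (inj₁ p))) = inj₂ (next⇒prev (next-unique (inj₂ p)))
adjacent⇒next⊎prev (inj₂ (inj₂ (inj₂ p))) = inj₁ (next-unique (inj₂ p))

ball₁ around : ∀ {k} → Fin k → List (Fin k)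
ball₁  a = prev a ∷ a ∷ next a ∷ []
around a = prev (prev a) ∷ prev a ∷ next a ∷ next (next a) ∷ []

∈ball₁ : ∀ {k} (a : Fin k) → a ∈ ball₁ a
∈ball₁ a = there (here refl)

adjacent∈ball₁ : ∀ {k} {a b : Fin k} → CycleAdj k a b → b ∈ ball₁ a
adjacent∈ball₁ adj with adjacent⇒next⊎prev adj
... | inj₁ refl = there (there (here refl))
... | inj₂ refl = here refl

adjacent∈around : ∀ {k} {a b : Fin k} → CycleAdj k a b → b ∈ around a
adjacent∈around adj with adjacent⇒next⊎prev adj
... | inj₁ refl = there (there (here refl))
... | inj₂ refl = there (here refl)

walk₂∈around : ∀ {k} {a b c : Fin k} → CycleAdj k a b → CycleAdj k b c → c ≡ a ⊎ c ∈ around a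
walk₂∈around {a = a} ab bc with adjacent⇒next⊎prev ab | adjacent⇒next⊎prev bc
... | inj₁ refl | inj₁ refl = inj₂ (there (there (there (here refl))))
... | inj₁ refl | inj₂ refl = inj₁ (prev-next a)
... | inj₂ refl | inj₁ refl = inj₁ (next-prev a)
... | inj₂ refl | inj₂ refl = inj₂ (here refl)

data Nbr (k : ℕ) : ℕ → ℕ → Set where
  step⁺ : ∀ {x} → Nbr k x (suc x)
  step⁻ : ∀ {x} → Nbr k (suc x) x
  wrap  : ∀ {x} → suc x ≡ k → Nbr k x 0

Nbr⇒Dist1 : ∀ {k x y} {a b : Fin k} → 2 ≤ k → Nbr k x y → toℕ a ≡ x → toℕ b ≡ y →
            Dist1 (Cycle k) a b
Nbr⇒Dist1 _ step⁺ refl b≡a+1 =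
  (λ b≡a → 1+n≢n (trans (sym b≡a+1) (cong toℕ b≡a))) , inj₁ (sym b≡a+1)
Nbr⇒Dist1 _ step⁻ a≡b+1 refl =
  (λ b≡a → 1+n≢n (trans (sym a≡b+1) (cong toℕ (sym b≡a)))) , inj₂ (inj₁ (sym a≡b+1))
Nbr⇒Dist1 {k} {a = a} {b} k≥2 (wrap a+1≡k) refl b≡0 = b≢a , inj₂ (inj₂ (inj₂ (b≡0 , a+1≡k)))
  where
  b≢a : b ≢ a
  b≢a b≡a = 1+n≰n (subst (2 ≤_) (trans (sym a+1≡k) (cong suc (trans (cong toℕ (sym b≡a)) b≡0))) k≥2)

Dist2-+2 : ∀ {k} {a b : Fin k} → 4 ≤ k → 2 + toℕ a ≡ toℕ b → Dist2 (Cycle k) a b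
Dist2-+2 {k} {a} {b} k≥4 a+2≡b =
  b≢a , not-adjacent , c , inj₁ (sym c≡a+1) , inj₁ (trans (cong suc c≡a+1) a+2≡b)
  where
  a+1<k : suc (toℕ a) < k
  a+1<k = ≤-trans (n≤1+n _) (subst (_< k) (sym a+2≡b) (toℕ<n b))
  c : Fin k
  c = fromℕ< a+1<k
  c≡a+1 : toℕ c ≡ suc (toℕ a)
  c≡a+1 = toℕ-fromℕ< a+1<k
  b≢a : b ≢ a
  b≢a b≡a = m+1+n≢n 1 (trans a+2≡b (cong toℕ b≡a))
  not-adjacent : ¬ CycleAdj k a b
  not-adjacent (inj₁ a+1≡b)                       = 1+n≢n (sym (trans a+1≡b (sym a+2≡b)))
  not-adjacent (inj₂ (inj₁ b+1≡a))                = m+1+n≢n 2 (trans (cong suc a+2≡b) b+1≡a)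
  not-adjacent (inj₂ (inj₂ (inj₁ (a≡0 , b+1≡k)))) =
    <-irrefl refl (subst (4 ≤_) (trans (sym b+1≡k) (cong suc (trans (sym a+2≡b) (cong (2 +_) a≡0)))) k≥4)
  not-adjacent (inj₂ (inj₂ (inj₂ (b≡0 , _))))     = 1+n≢0 (trans a+2≡b b≡0)

count : ℕ → (ℕ → Bool) → ℕ
count zero    P = 0
count (suc k) P = if P k then suc (count k P) else count k P

count-cong : ∀ k {P Q : ℕ → Bool} → (∀ {x} → x < k → P x ≡ Q x) → count k P ≡ count k Q
count-cong zero    _   = refl
count-cong (suc k) P≗Q =
  cong₂ (λ b c → if b then suc c else c) (P≗Q ≤-refl) (count-cong k (P≗Q ∘ m<n⇒m<1+n))

count-suc : ∀ k (P : ℕ → Bool) →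
            count (suc k) P ≡ (if P 0 then suc (count k (P ∘ suc)) else count k (P ∘ suc))
count-suc zero P with P 0
... | true  = refl
... | false = refl
count-suc (suc k) P with P 0 | P (suc k) | count-suc k P
... | true  | true  | eq = cong suc eq
... | true  | false | eq = eq
... | false | true  | eq = cong suc eq
... | false | false | eq = eq

length-filter-allFin : ∀ {P : ℕ → Set} (P? : ∀ x → Dec (P x)) k →
                       length (filter (P? ∘ toℕ) (allFin k)) ≡ count k (does ∘ P?)
length-filter-allFin P? zero    = refl
length-filter-allFin P? (suc k) = begin
  length (filter (P? ∘ toℕ) (zero ∷ tabulate {n = k} suc))
    ≡⟨ length-filter-∷ (P? ∘ toℕ) zero (tabulate {n = k} suc) ⟩
  (if does (P? 0) then suc (length (filter (P? ∘ toℕ) (tabulate {n = k} suc)))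
                  else length (filter (P? ∘ toℕ) (tabulate {n = k} suc)))
    ≡⟨ cong (λ c → if does (P? 0) then suc c else c) shifted ⟩
  (if does (P? 0) then suc (count k (does ∘ P? ∘ suc)) else count k (does ∘ P? ∘ suc))
    ≡⟨ sym (count-suc k (does ∘ P?)) ⟩
  count (suc k) (does ∘ P?) ∎
  where
  open ≡-Reasoning
  shifted : length (filter (P? ∘ toℕ) (tabulate {n = k} suc)) ≡ count k (does ∘ P? ∘ suc)
  shifted = begin
    length (filter (P? ∘ toℕ) (tabulate {n = k} suc))
      ≡⟨ cong (length ∘ filter (P? ∘ toℕ)) (sym (map-tabulate {n = k} id suc)) ⟩
    length (filter (P? ∘ toℕ) (map suc (allFin k)))
      ≡⟨ length-filter-map (P? ∘ toℕ) suc (allFin k) ⟩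
    length (filter (P? ∘ suc ∘ toℕ) (allFin k))
      ≡⟨ length-filter-allFin (P? ∘ suc) k ⟩
    count k (does ∘ P? ∘ suc) ∎

-- The labelling of C_k

data Phase : Set where
  φ₀ φ₁ φ₂ φ₃ : Phase

rotate : Phase → Phase
rotate φ₀ = φ₁
rotate φ₁ = φ₂
rotate φ₂ = φ₃
rotate φ₃ = φ₀

phase : ℕ → Phase
phase zero    = φ₀
phase (suc x) = rotate (phase x)

data Label : Set where
  Z T O : Label

_≟ᴸ_ : DecidableEquality Label
Z ≟ᴸ Z = yes refl
T ≟ᴸ T = yes refl
O ≟ᴸ O = yes refl
Z ≟ᴸ T = no λ ()
Z ≟ᴸ O = no λ ()
T ≟ᴸ Z = no λ ()
T ≟ᴸ O = no λ ()
O ≟ᴸ Z = no λ ()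
O ≟ᴸ T = no λ ()

label : ℕ → ℕ → Label
label k x with phase x | suc x ℕ.≟ k
... | φ₀ | _     = Z
... | φ₁ | yes _ = T
... | φ₁ | no _  = O
... | φ₂ | _     = T
... | φ₃ | _     = O

label-φ₀ : ∀ {k x} → phase x ≡ φ₀ → label k x ≡ Z
label-φ₀ {k} {x} p with phase x | suc x ℕ.≟ k
label-φ₀ refl | φ₀ | _ = refl

label-φ₂ : ∀ {k x} → phase x ≡ φ₂ → label k x ≡ T
label-φ₂ {k} {x} p with phase x | suc x ℕ.≟ k
label-φ₂ refl | φ₂ | _ = refl

NearAt TwoApartAt : ℕ → Label → ℕ → Set
NearAt     k L x = ∃[ y ] (y < k × Nbr k x y × label k y ≡ L)
TwoApartAt k L x = ∃[ y ] (y < k × (2 + x ≡ y ⊎ 2 + y ≡ x) × label k y ≡ L)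

nearAt-O : ∀ {k x} → x < k → label k x ≡ O → NearAt k Z x × NearAt k T x
nearAt-O {k} {suc y} x<k lx with phase y in ph | suc (suc y) ℕ.≟ k
nearAt-O {k} {suc y} x<k () | φ₀ | yes _
... | φ₀ | no x+1≢k =
  (y , <⇒≤ x<k , step⁻ , label-φ₀ ph) ,
  (suc (suc y) , ≤∧≢⇒< x<k x+1≢k , step⁺ , label-φ₂ (cong (rotate ∘ rotate) ph))
... | φ₂ | yes x+1≡k =
  (0 , ≤-trans (s≤s z≤n) x<k , wrap x+1≡k , refl) ,
  (y , <⇒≤ x<k , step⁻ , label-φ₂ ph)
... | φ₂ | no x+1≢k =
  (suc (suc y) , ≤∧≢⇒< x<k x+1≢k , step⁺ , label-φ₀ (cong (rotate ∘ rotate) ph)) ,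
  (y , <⇒≤ x<k , step⁻ , label-φ₂ ph)

twoApartAt-Z : ∀ {k x} → 3 ≤ k → x < k → label k x ≡ Z → TwoApartAt k T x
twoApartAt-Z {x = zero} k≥3 _ _ = 2 , k≥3 , inj₁ refl , refl
twoApartAt-Z {k} {suc zero} _ _ lx with 2 ℕ.≟ k
twoApartAt-Z {k} {suc zero} _ _ () | yes _
twoApartAt-Z {k} {suc zero} _ _ () | no _
twoApartAt-Z {k} {suc (suc z)} _ x<k lx with phase z in ph | suc (suc (suc z)) ℕ.≟ k
... | φ₂ | _ = z , <-trans (n<1+n z) (<⇒≤ x<k) , inj₂ refl , label-φ₂ ph
twoApartAt-Z {k} {suc (suc z)} _ _ () | φ₃ | yes _
twoApartAt-Z {k} {suc (suc z)} _ _ () | φ₃ | no _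

nearAt⊎twoApartAt-T : ∀ {k x} → x < k → label k x ≡ T → NearAt k Z x ⊎ TwoApartAt k Z x
nearAt⊎twoApartAt-T {k} {suc zero} x<k lx with 2 ℕ.≟ k
... | yes x+1≡k = inj₁ (0 , ≤-trans (s≤s z≤n) x<k , wrap x+1≡k , refl)
nearAt⊎twoApartAt-T {k} {suc zero} _ () | no _
nearAt⊎twoApartAt-T {k} {suc (suc z)} x<k lx with phase z in ph | suc (suc (suc z)) ℕ.≟ k
... | φ₀ | _         = inj₂ (z , <-trans (n<1+n z) (<⇒≤ x<k) , inj₂ refl , label-φ₀ ph)
... | φ₃ | yes x+1≡k = inj₁ (0 , ≤-trans (s≤s z≤n) x<k , wrap x+1≡k , refl)
nearAt⊎twoApartAt-T {k} {suc (suc z)} _ () | φ₃ | no _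

Near TwoApart : (k : ℕ) → Label → Fin k → Set
Near     k L a = ∃[ b ] (Dist1 (Cycle k) a b × label k (toℕ b) ≡ L)
TwoApart k L a = ∃[ b ] (Dist2 (Cycle k) a b × label k (toℕ b) ≡ L)

module _ {k : ℕ} (k≥4 : 4 ≤ k) (a : Fin k) where

  private
    near : ∀ {L} → NearAt k L (toℕ a) → Near k L a
    near (y , y<k , nbr , ly) =
      fromℕ< y<k , Nbr⇒Dist1 (≤-trans (m≤m+n 2 2) k≥4) nbr refl (toℕ-fromℕ< y<k) ,
      trans (cong (label k) (toℕ-fromℕ< y<k)) ly

    twoApart : ∀ {L} → TwoApartAt k L (toℕ a) → TwoApart k L a
    twoApart (y , y<k , inj₁ a+2≡y , ly) =
      fromℕ< y<k , Dist2-+2 k≥4 (trans a+2≡y (sym (toℕ-fromℕ< y<k))) ,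
      trans (cong (label k) (toℕ-fromℕ< y<k)) ly
    twoApart (y , y<k , inj₂ y+2≡a , ly) =
      fromℕ< y<k , Dist2-sym CycleAdj-sym (Dist2-+2 k≥4 (trans (cong (2 +_) (toℕ-fromℕ< y<k)) y+2≡a)) ,
      trans (cong (label k) (toℕ-fromℕ< y<k)) ly

  near-O : label k (toℕ a) ≡ O → Near k Z a × Near k T a
  near-O la = let (z , t) = nearAt-O (toℕ<n a) la in near z , near t

  twoApart-Z : label k (toℕ a) ≡ Z → TwoApart k T a
  twoApart-Z la = twoApart (twoApartAt-Z (≤-trans (n≤1+n 3) k≥4) (toℕ<n a) la)

  near⊎twoApart-T : label k (toℕ a) ≡ T → Near k Z a ⊎ TwoApart k Z a
  near⊎twoApart-T la with nearAt⊎twoApartAt-T (toℕ<n a) la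
  ... | inj₁ z = inj₁ (near z)
  ... | inj₂ z = inj₂ (twoApart z)

isφ₀ isφ₂ endsT : Phase → Bool
isφ₀ φ₀ = true
isφ₀ _  = false
isφ₂ φ₂ = true
isφ₂ _  = false
endsT φ₁ = true
endsT φ₂ = true
endsT _  = false

suc-≤-/4 : ∀ {c} r → c ≤ r / 4 → suc c ≤ (4 + r) / 4
suc-≤-/4 {c} r c≤r/4 = subst (suc c ≤_) (sym (m/n≡1+[m∸n]/n (m≤m+n 4 r))) (s≤s c≤r/4)

count-φ₀ : ∀ k → count k (isφ₀ ∘ phase) ≤ (k + 3) / 4
count-φ₀ 0 = z≤n
count-φ₀ 1 = ≤-refl
count-φ₀ 2 = ≤-refl
count-φ₀ 3 = ≤-refl
count-φ₀ (suc (suc (suc (suc k)))) with phase k | count-φ₀ k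
... | φ₀ | ih = suc-≤-/4 (k + 3) ih
... | φ₁ | ih = suc-≤-/4 (k + 3) ih
... | φ₂ | ih = suc-≤-/4 (k + 3) ih
... | φ₃ | ih = suc-≤-/4 (k + 3) ih

count-φ₂-endsT : ∀ j → (if endsT (phase j) then suc (count j (isφ₂ ∘ phase))
                                           else count j (isφ₂ ∘ phase))
                       ≤ (suc j + 3) / 4
count-φ₂-endsT 0 = z≤n
count-φ₂-endsT 1 = ≤-refl
count-φ₂-endsT 2 = ≤-refl
count-φ₂-endsT 3 = ≤-refl
count-φ₂-endsT (suc (suc (suc (suc j)))) with phase j | count-φ₂-endsT j
... | φ₀ | ih = suc-≤-/4 (suc j + 3) ih
... | φ₁ | ih = suc-≤-/4 (suc j + 3) ih
... | φ₂ | ih = suc-≤-/4 (suc j + 3) ih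
... | φ₃ | ih = suc-≤-/4 (suc j + 3) ih

label≟Z : ∀ k x → does (label k x ≟ᴸ Z) ≡ isφ₀ (phase x)
label≟Z k x with phase x | suc x ℕ.≟ k
... | φ₀ | _     = refl
... | φ₁ | yes _ = refl
... | φ₁ | no _  = refl
... | φ₂ | _     = refl
... | φ₃ | _     = refl

label≟T-inner : ∀ {j x} → x < j → does (label (suc j) x ≟ᴸ T) ≡ isφ₂ (phase x)
label≟T-inner {j} {x} x<j with phase x | suc x ℕ.≟ suc j
... | φ₀ | _         = refl
... | φ₁ | yes x+1≡j+1 = ⊥-elim (<⇒≢ x<j (suc-injective x+1≡j+1))
... | φ₁ | no _      = refl
... | φ₂ | _         = refl
... | φ₃ | _         = refl

label≟T-last : ∀ j → does (label (suc j) j ≟ᴸ T) ≡ endsT (phase j)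
label≟T-last j with phase j | suc j ℕ.≟ suc j
... | φ₀ | _      = refl
... | φ₁ | yes _  = refl
... | φ₁ | no j≢j = ⊥-elim (j≢j refl)
... | φ₂ | _      = refl
... | φ₃ | _      = refl

count-Z : ∀ k → count k (λ x → does (label k x ≟ᴸ Z)) ≤ (k + 3) / 4
count-Z k = subst (_≤ (k + 3) / 4) (sym (count-cong k (λ {x} _ → label≟Z k x))) (count-φ₀ k)

count-T : ∀ k → count k (λ x → does (label k x ≟ᴸ T)) ≤ (k + 3) / 4
count-T zero    = z≤n
count-T (suc j) = subst (_≤ (suc j + 3) / 4) (sym split-last) (count-φ₂-endsT j)
  where
  split-last : count (suc j) (λ x → does (label (suc j) x ≟ᴸ T)) ≡
               (if endsT (phase j) then suc (count j (isφ₂ ∘ phase)) else count j (isφ₂ ∘ phase))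
  split-last = cong₂ (λ b c → if b then suc c else c) (label≟T-last j) (count-cong j label≟T-inner)

marked : (k : ℕ) → Label → List (Fin k)
marked k L = filter (λ a → label k (toℕ a) ≟ᴸ L) (allFin k)

∈-marked : ∀ {k L} {a : Fin k} → label k (toℕ a) ≡ L → a ∈ marked k L
∈-marked {k} {L} {a} = ∈-filter⁺ (λ a → label k (toℕ a) ≟ᴸ L) (∈-allFin a)

marked-label : ∀ {k L} {a : Fin k} → a ∈ marked k L → label k (toℕ a) ≡ L
marked-label {k} {L} = proj₂ ∘ ∈-filter⁻ (λ a → label k (toℕ a) ≟ᴸ L) {xs = allFin k}

marked-unique : ∀ k L → Unique (marked k L)
marked-unique k L = Unique.filter⁺ (λ a → label k (toℕ a) ≟ᴸ L) (Unique.allFin⁺ k)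

length-marked-Z : ∀ k → length (marked k Z) ≤ (k + 3) / 4
length-marked-Z k = subst (_≤ (k + 3) / 4) (sym (length-filter-allFin (λ x → label k x ≟ᴸ Z) k)) (count-Z k)

length-marked-T : ∀ k → length (marked k T) ≤ (k + 3) / 4
length-marked-T k = subst (_≤ (k + 3) / 4) (sym (length-filter-allFin (λ x → label k x ≟ᴸ T) k)) (count-T k)

-- The torus C_m □ C_n

module TorusGrid (m n : ℕ) where

  Γ : Graph
  Γ = Torus m n

  _≟ᵛ_ : DecidableEquality (Fin m × Fin n)
  _≟ᵛ_ = ≡-dec Fin._≟_ Fin._≟_

  vertices : List (Fin m × Fin n)
  vertices = cartesianProduct (allFin m) (allFin n)

  vertices! : Unique vertices
  vertices! = Unique.cartesianProduct⁺ (Unique.allFin⁺ m) (Unique.allFin⁺ n)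

  ∈-vertices : ∀ v → v ∈ vertices
  ∈-vertices (a , b) = ∈-cartesianProduct⁺ (∈-allFin a) (∈-allFin b)

  length-vertices : length vertices ≡ m * n
  length-vertices = trans (length-cartesianProduct (allFin m) (allFin n))
                          (cong₂ _*_ (length-tabulate {n = m} id) (length-tabulate {n = n} id))

  open CartesianProduct (Cycle m) (Cycle n)
  open FiniteGraph Γ _≟ᵛ_ (□-Adj? Fin._≟_ Fin._≟_ (CycleAdj? m) (CycleAdj? n))
                   vertices vertices! ∈-vertices public

  lines : Fin m → Fin n → List (Fin m × Fin n)
  lines a b = map (_, b) (a ∷ around a) ++ map (a ,_) (around b)

  -- Both the 3 × 3 square and the two lines through s contain the closed
  -- neighbourhood of s; besides, the square contains the four diagonal vertices and
  -- the lines the four vertices two steps away along one coordinate.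
  stamp : Fin m × Fin n → List (Fin m × Fin n)
  stamp (a , b) = cartesianProduct (ball₁ a) (ball₁ b) ++ lines a b

  length-stamp : ∀ s → length (stamp s) ≡ 18
  length-stamp (a , b) = refl

  square⊆stamp : ∀ {a a′ b b′} → a′ ∈ ball₁ a → b′ ∈ ball₁ b → (a′ , b′) ∈ stamp (a , b)
  square⊆stamp a′∈ b′∈ = ∈-++⁺ˡ (∈-cartesianProduct⁺ a′∈ b′∈)

  lines⊆stamp : ∀ {v a b} → v ∈ lines a b → v ∈ stamp (a , b)
  lines⊆stamp {a = a} {b} = ∈-++⁺ʳ (cartesianProduct (ball₁ a) (ball₁ b))

  ∈linesˡ : ∀ {a a′ b} → a′ ∈ a ∷ around a → (a′ , b) ∈ lines a b
  ∈linesˡ {b = b} a′∈ = ∈-++⁺ˡ (∈-map⁺ (_, b) a′∈)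

  ∈linesʳ : ∀ {a b b′} → b′ ∈ around b → (a , b′) ∈ lines a b
  ∈linesʳ {a} {b} b′∈ = ∈-++⁺ʳ (map (_, b) (a ∷ around a)) (∈-map⁺ (a ,_) b′∈)

  square∩lines⇒2≤multiplicity : ∀ {a a′ b b′} → a′ ∈ ball₁ a → b′ ∈ ball₁ b →
                                 (a′ , b′) ∈ lines a b → 2 ≤ multiplicity (a′ , b′) (stamp (a , b))
  square∩lines⇒2≤multiplicity {a} {a′} {b} {b′} a′∈ b′∈ v∈lines =
    subst (2 ≤_) (sym (multiplicity-++ (a′ , b′) (cartesianProduct (ball₁ a) (ball₁ b)) (lines a b)))
          (+-mono-≤ (∈⇒1≤multiplicity (∈-cartesianProduct⁺ a′∈ b′∈))
                    (∈⇒1≤multiplicity v∈lines))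

  stamp-self : ∀ s → 2 ≤ multiplicity s (stamp s)
  stamp-self (a , b) = square∩lines⇒2≤multiplicity (∈ball₁ a) (∈ball₁ b) (∈linesˡ (here refl))

  stamp-adj : ∀ {v s} → Adj Γ v s → 2 ≤ multiplicity v (stamp s)
  stamp-adj {_ , b′} {a , b} (inj₁ (refl , b′b)) =
    square∩lines⇒2≤multiplicity (∈ball₁ a) (adjacent∈ball₁ (CycleAdj-sym b′b))
                                (∈linesʳ (adjacent∈around (CycleAdj-sym b′b)))
  stamp-adj {a′ , _} {a , b} (inj₂ (refl , a′a)) =
    square∩lines⇒2≤multiplicity (adjacent∈ball₁ (CycleAdj-sym a′a)) (∈ball₁ b)
                                (∈linesˡ (there (adjacent∈around (CycleAdj-sym a′a))))

  stamp-walk : ∀ {v w s} → Adj Γ v w → Adj Γ w s → v ∈ stamp s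
  stamp-walk (inj₁ (refl , b′b₁)) (inj₁ (refl , b₁b))
    with walk₂∈around (CycleAdj-sym b₁b) (CycleAdj-sym b′b₁)
  ... | inj₁ refl = lines⊆stamp (∈linesˡ (here refl))
  ... | inj₂ b′∈  = lines⊆stamp (∈linesʳ b′∈)
  stamp-walk (inj₂ (refl , a′a₁)) (inj₁ (refl , b₁b)) =
    square⊆stamp (adjacent∈ball₁ (CycleAdj-sym a′a₁)) (adjacent∈ball₁ (CycleAdj-sym b₁b))
  stamp-walk (inj₁ (refl , b′b₁)) (inj₂ (refl , a₁a)) =
    square⊆stamp (adjacent∈ball₁ (CycleAdj-sym a₁a)) (adjacent∈ball₁ (CycleAdj-sym b′b₁))
  stamp-walk (inj₂ (refl , a′a₁)) (inj₂ (refl , a₁a))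
    with walk₂∈around (CycleAdj-sym a₁a) (CycleAdj-sym a′a₁)
  ... | inj₁ refl = lines⊆stamp (∈linesˡ (here refl))
  ... | inj₂ a′∈  = lines⊆stamp (∈linesˡ (there a′∈))

  open Weighting stamp 18 length-stamp stamp-self stamp-adj stamp-walk

  torus-lower-bound : ∀ {S} → IsDisjDomSet Γ S → m * n ≤ 9 * length S
  torus-lower-bound {S} dS = *-cancelˡ-≤ 2 (begin
    2 * (m * n)         ≡⟨ cong (2 *_) (sym length-vertices) ⟩
    2 * length vertices ≤⟨ disjDom-lower-bound dS ⟩
    18 * length S       ≡⟨ *-assoc 2 9 (length S) ⟩
    2 * (9 * length S)  ∎)
    where open ≤-Reasoning

  latticeSet : List (Fin m × Fin n)
  latticeSet = cartesianProduct (marked m Z) (marked n Z) ++ cartesianProduct (marked m T) (marked n T)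

  ∈-latticeSet-Z : ∀ {a b} → label m (toℕ a) ≡ Z → label n (toℕ b) ≡ Z → (a , b) ∈ latticeSet
  ∈-latticeSet-Z la lb = ∈-++⁺ˡ (∈-cartesianProduct⁺ (∈-marked la) (∈-marked lb))

  ∈-latticeSet-T : ∀ {a b} → label m (toℕ a) ≡ T → label n (toℕ b) ≡ T → (a , b) ∈ latticeSet
  ∈-latticeSet-T la lb =
    ∈-++⁺ʳ (cartesianProduct (marked m Z) (marked n Z)) (∈-cartesianProduct⁺ (∈-marked la) (∈-marked lb))

  latticeSet-unique : Unique latticeSet
  latticeSet-unique = Unique.++⁺ (Unique.cartesianProduct⁺ (marked-unique m Z) (marked-unique n Z))
                                 (Unique.cartesianProduct⁺ (marked-unique m T) (marked-unique n T))
                                 disjoint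
    where
    disjoint : ∀ {v} → ¬ (v ∈ cartesianProduct (marked m Z) (marked n Z) ×
                          v ∈ cartesianProduct (marked m T) (marked n T))
    disjoint (v∈ZZ , v∈TT)
      with trans (sym (marked-label (proj₁ (∈-cartesianProduct⁻ (marked m Z) (marked n Z) v∈ZZ))))
                 (marked-label (proj₁ (∈-cartesianProduct⁻ (marked m T) (marked n T) v∈TT)))
    ... | ()

  latticeSet-dominates : 4 ≤ m → 4 ≤ n → ∀ a b → ¬ (a , b) ∈ latticeSet →
                         Dominated Γ latticeSet (a , b)
  latticeSet-dominates m≥4 n≥4 a b ∉S with label m (toℕ a) in la | label n (toℕ b) in lb
  ... | Z | Z = ⊥-elim (∉S (∈-latticeSet-Z la lb))
  ... | T | T = ⊥-elim (∉S (∈-latticeSet-T la lb))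
  ... | O | Z = let ((a′ , d , la′) , _) = near-O m≥4 a la
                in inj₁ ((a′ , b) , ∈-latticeSet-Z la′ lb , □-Dist1ˡ d)
  ... | O | T = let (_ , (a′ , d , la′)) = near-O m≥4 a la
                in inj₁ ((a′ , b) , ∈-latticeSet-T la′ lb , □-Dist1ˡ d)
  ... | Z | O = let ((b′ , d , lb′) , _) = near-O n≥4 b lb
                in inj₁ ((a , b′) , ∈-latticeSet-Z la lb′ , □-Dist1ʳ d)
  ... | T | O = let (_ , (b′ , d , lb′)) = near-O n≥4 b lb
                in inj₁ ((a , b′) , ∈-latticeSet-T la lb′ , □-Dist1ʳ d)
  ... | O | O =
    let ((a₁ , d₁ , la₁) , (a₂ , d₂ , la₂)) = near-O m≥4 a la
        ((b₁ , e₁ , lb₁) , (b₂ , e₂ , lb₂)) = near-O n≥4 b lb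
    in inj₂ ((a₁ , b₁) , (a₂ , b₂) ,
             (λ e → Z≢T (trans (sym la₁) (trans (cong (label m ∘ toℕ ∘ proj₁) e) la₂))) ,
             ∈-latticeSet-Z la₁ lb₁ , ∈-latticeSet-T la₂ lb₂ ,
             □-Dist2-diagonal d₁ e₁ , □-Dist2-diagonal d₂ e₂)
    where
    Z≢T : Z ≢ T
    Z≢T ()
  ... | Z | T with twoApart-Z m≥4 a la | near⊎twoApart-T n≥4 b lb
  ...   | _              | inj₁ (b′ , d , lb′) = inj₁ ((a , b′) , ∈-latticeSet-Z la lb′ , □-Dist1ʳ d)
  ...   | (a′ , d , la′) | inj₂ (b′ , e , lb′) =
    inj₂ ((a′ , b) , (a , b′) , proj₁ d ∘ cong proj₁ , ∈-latticeSet-T la′ lb , ∈-latticeSet-Z la lb′ ,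
          □-Dist2ˡ d , □-Dist2ʳ e)
  latticeSet-dominates m≥4 n≥4 a b ∉S | T | Z with near⊎twoApart-T m≥4 a la | twoApart-Z n≥4 b lb
  ...   | inj₁ (a′ , d , la′) | _              = inj₁ ((a′ , b) , ∈-latticeSet-Z la′ lb , □-Dist1ˡ d)
  ...   | inj₂ (a′ , d , la′) | (b′ , e , lb′) =
    inj₂ ((a′ , b) , (a , b′) , proj₁ d ∘ cong proj₁ , ∈-latticeSet-Z la′ lb , ∈-latticeSet-T la lb′ ,
          □-Dist2ˡ d , □-Dist2ʳ e)

  latticeSet-dominating : 4 ≤ m → 4 ≤ n → IsDisjDomSet Γ latticeSet
  latticeSet-dominating m≥4 n≥4 = latticeSet-unique , λ { (a , b) → latticeSet-dominates m≥4 n≥4 a b }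

  length-latticeSet : length latticeSet ≤ 2 * ((m + 3) / 4) * ((n + 3) / 4)
  length-latticeSet = begin
    length latticeSet
      ≡⟨ length-++ (cartesianProduct (marked m Z) (marked n Z)) ⟩
    length (cartesianProduct (marked m Z) (marked n Z)) + length (cartesianProduct (marked m T) (marked n T))
      ≡⟨ cong₂ _+_ (length-cartesianProduct (marked m Z) (marked n Z))
                   (length-cartesianProduct (marked m T) (marked n T)) ⟩
    length (marked m Z) * length (marked n Z) + length (marked m T) * length (marked n T)
      ≤⟨ +-mono-≤ (*-mono-≤ (length-marked-Z m) (length-marked-Z n))
                  (*-mono-≤ (length-marked-T m) (length-marked-T n)) ⟩
    p * q + p * q
      ≡⟨ cong (p * q +_) (sym (+-identityʳ (p * q))) ⟩
    2 * (p * q)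
      ≡⟨ sym (*-assoc 2 p q) ⟩
    2 * p * q ∎
    where
    open ≤-Reasoning
    p = (m + 3) / 4
    q = (n + 3) / 4

theorem1p1 : (m n : ℕ) → 5 ≤ m → 5 ≤ n →
    ∃[ γ ] (IsDisjDomNumber (Torus m n) γ ×
            m * n ≤ 9 * γ ×
            γ ≤ 2 * ((m + 3) / 4) * ((n + 3) / 4))
theorem1p1 m n m≥5 n≥5 =
  let open TorusGrid m n
      dominating = latticeSet-dominating (<⇒≤ m≥5) (<⇒≤ n≥5)
      (γ , isNumber) = disjDomNumber dominating
      ((S , dS , |S|≡γ) , minimal) = isNumber
  in γ , isNumber ,
     subst (λ ℓ → m * n ≤ 9 * ℓ) |S|≡γ (torus-lower-bound dS) ,
     ≤-trans (minimal latticeSet dominating) length-latticeSet
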